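{- Let $G$ be a subcubic graph of order $n$, $\pi=\{V_1,\dots,V_k\}$ a connected coalition partition of $G$, and $H=CCG(G,\pi)$. If $H$ contains an isolated vertex, then $n=k\le 4$, $G\cong K_n$ and $H\cong\overline{K}_n$.
   Context: Graphs are finite and simple. A graph is subcubic if it is connected and its maximum vertex degree is at most 3. $G[S]$ is the induced subgraph. A set $D\subseteq V$ is dominating if every vertex of $V\setminus D$ has a neighbour in $D$; connected dominating if moreover $G[D]$ is connected. Two disjoint subsets $A,B\subseteq V$ form a connected coalition if neither is a connected dominating set but $A\cup B$ is. A connected coalition partition of $G$ is a partition $\pi=\{V_1,\dots,V_k\}$ of $V$ such that each $V_i$ either is a connected dominating set consisting of a single vertex or forms a connected coalition with some set of $\pi$. The coalition graph $CCG(G,\pi)$ has vertex set $\{V_1,\dots,V_k\}$, with $V_i\sim V_j$ iff they form a connected coalition. $\overline{K}_n$ is the edgeless graph on $n$ vertices. -}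

module Defs where

open import Data.Nat using (ℕ; _≤_)
open import Data.Bool using (Bool; true; false)
open import Data.Fin using (Fin)
open import Data.Fin.Subset using (Subset; ∣_∣)
open import Data.Vec using (tabulate)
open import Data.Product using (Σ; ∃; ∃-syntax; _×_; _,_)
open import Data.Sum using (_⊎_)
open import Data.Empty using (⊥)
open import Relation.Nullary using (¬_)
open import Relation.Binary.PropositionalEquality using (_≡_; _≢_)
open import Function.Bundles using (_↔_; _⇔_; Inverse)

record Graph (n : ℕ) : Set where
  field
    adj   : Fin n → Fin n → Bool
    sym   : ∀ u v → adj u v ≡ adj v u
    irrfl : ∀ v → adj v v ≡ false

module _ {n : ℕ} (G : Graph n) where
  open Graph G

  E : Fin n → Fin n → Set
  E u v = adj u v ≡ true

  VSet : Set₁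
  VSet = Fin n → Set

  degree : Fin n → ℕ
  degree v = ∣ tabulate (adj v) ∣

  data WalkIn (S : VSet) : Fin n → Fin n → Set where
    here : ∀ {v} → S v → WalkIn S v v
    step : ∀ {u w v} → S u → E u w → WalkIn S w v → WalkIn S u v

  ConnectedIn : VSet → Set
  ConnectedIn S = (∃[ v ] S v) × (∀ u v → S u → S v → WalkIn S u v)

  Dominating : VSet → Set
  Dominating D = ∀ v → ¬ D v → ∃[ u ] (D u × E v u)

  CDS : VSet → Set
  CDS D = Dominating D × ConnectedIn D

  _∪_ : VSet → VSet → VSet
  (A ∪ B) v = A v ⊎ B v

  Disjoint : VSet → VSet → Set
  Disjoint A B = ∀ v → A v → B v → ⊥

  ConnCoalition : VSet → VSet → Set
  ConnCoalition A B = Disjoint A B × ¬ CDS A × ¬ CDS B × CDS (A ∪ B)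

  Subcubic : Set
  Subcubic = ConnectedIn (λ _ → Fin n) × (∀ v → degree v ≤ 3)

  record Partition (k : ℕ) : Set where
    field
      part     : Fin n → Fin k
      nonempty : ∀ i → ∃[ v ] part v ≡ i

    block : Fin k → VSet
    block i v = part v ≡ i

  open Partition public

  SingletonBlock : VSet → Set
  SingletonBlock S = ∃[ v ] (∀ u → S u ⇔ (u ≡ v))

  IsConnCoalitionPartition : ∀ {k} → Partition k → Set
  IsConnCoalitionPartition {k} π =
    ∀ i → (CDS (block π i) × SingletonBlock (block π i))
          ⊎ (∃[ j ] ConnCoalition (block π i) (block π j))

  CCG : ∀ {k} → Partition k → Fin k → Fin k → Set
  CCG π i j = ConnCoalition (block π i) (block π j)

Iso : ∀ {n m} → (Fin n → Fin n → Set) → (Fin m → Fin m → Set) → Set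
Iso {n} {m} R S = Σ (Fin n ↔ Fin m) λ f → ∀ u v → R u v ⇔ S (Inverse.to f u) (Inverse.to f v)

Kadj : ∀ n → Fin n → Fin n → Set
Kadj n u v = u ≢ v

Kbar : ∀ n → Fin n → Fin n → Set
Kbar n u v = ⊥

IsolatedIn : ∀ {k} → (Fin k → Fin k → Set) → Fin k → Set
IsolatedIn R i = ∀ j → ¬ R i j

{-# OPTIONS --safe #-}
module Submission where

-- An isolated block of a connected coalition partition cannot be in a coalition, so it is a
-- singleton {v₀} dominating everything; v₀ is universal and subcubicity gives n ≤ 4. In a graph of
-- order at most 4 with a universal vertex, every connected dominating set contains a universal
-- vertex. A block in a coalition with B would therefore have a universal vertex in itself or in B,
-- making that block a connected dominating set on its own, which a coalition forbids. So every
-- block is a singleton connected dominating set: every vertex is universal and π is discrete.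

open import Defs
open import Data.Nat using (ℕ; _≤_; zero; suc; s≤s)
open import Data.Nat.Properties using (≤-trans; ≤-reflexive; ≤-refl; n≤1+n; ≤-antisym)
open import Data.Fin using (Fin; zero; suc; _≟_)
open import Data.Fin.Properties using (any?; pigeonhole; injective⇒≤; suc-injective)
open import Data.Fin.Subset using (∣_∣)
open import Data.Vec using (tabulate)
open import Data.Bool using (Bool; true; false)
import Data.Bool.Properties as Bool
open import Data.Product using (∃-syntax; _×_; _,_; proj₁; proj₂)
open import Data.Sum using (_⊎_; inj₁; inj₂)
open import Data.Empty using (⊥; ⊥-elim)
open import Relation.Nullary using (¬_; yes; no; Dec)
open import Relation.Nullary.Decidable using (¬?; _×-dec_; _⊎-dec_; ¬¬-excluded-middle)
open import Relation.Binary.PropositionalEquality using (_≡_; _≢_; refl; sym; trans; cong; subst)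
open import Function.Bundles using (_↔_; _⇔_; mk⇔; Equivalence)
open import Function.Construct.Identity using (↔-id)

∣tabulate-true∣ : ∀ {m} (f : Fin m → Bool) → (∀ u → f u ≡ true) → ∣ tabulate f ∣ ≡ m
∣tabulate-true∣ {zero}  f all-true = refl
∣tabulate-true∣ {suc m} f all-true rewrite all-true zero =
  cong suc (∣tabulate-true∣ (λ u → f (suc u)) (λ u → all-true (suc u)))

∣tabulate-tail∣≤ : ∀ {m} (f : Fin (suc m) → Bool) → ∣ tabulate (λ u → f (suc u)) ∣ ≤ ∣ tabulate f ∣
∣tabulate-tail∣≤ f with f zero
... | true  = n≤1+n _
... | false = ≤-refl

∣tabulate-true-except∣ : ∀ {m} (f : Fin m → Bool) (v : Fin m) →
  (∀ u → u ≢ v → f u ≡ true) → m ≤ suc ∣ tabulate f ∣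
∣tabulate-true-except∣ {suc m} f zero true-off-0 = s≤s (≤-trans
  (≤-reflexive (sym (∣tabulate-true∣ (λ u → f (suc u)) (λ u → true-off-0 (suc u) λ ()))))
  (∣tabulate-tail∣≤ f))
∣tabulate-true-except∣ {suc m} f (suc v) true-off-v rewrite true-off-v zero (λ ()) =
  s≤s (∣tabulate-true-except∣ (λ u → f (suc u)) v
         (λ u u≢v → true-off-v (suc u) (λ eq → u≢v (suc-injective eq))))

covered-by-four : ∀ {n} → n ≤ 4 → {a b c d : Fin n} →
  a ≢ b → a ≢ c → a ≢ d → b ≢ c → b ≢ d → c ≢ d →
  ∀ t → t ≡ a ⊎ t ≡ b ⊎ t ≡ c ⊎ t ≡ d
covered-by-four {n} n≤4 {a} {b} {c} {d} a≢b a≢c a≢d b≢c b≢d c≢d t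
  with t ≟ a ⊎-dec t ≟ b ⊎-dec t ≟ c ⊎-dec t ≟ d
... | yes t∈abcd = t∈abcd
... | no t∉abcd with pigeonhole (s≤s n≤4) five
  where
  five : Fin 5 → Fin n
  five zero                         = t
  five (suc zero)                   = a
  five (suc (suc zero))             = b
  five (suc (suc (suc zero)))       = c
  five (suc (suc (suc (suc zero)))) = d
... | zero , suc zero , _ , eq                         = ⊥-elim (t∉abcd (inj₁ eq))
... | zero , suc (suc zero) , _ , eq                   = ⊥-elim (t∉abcd (inj₂ (inj₁ eq)))
... | zero , suc (suc (suc zero)) , _ , eq             = ⊥-elim (t∉abcd (inj₂ (inj₂ (inj₁ eq))))
... | zero , suc (suc (suc (suc zero))) , _ , eq       = ⊥-elim (t∉abcd (inj₂ (inj₂ (inj₂ eq))))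
... | suc zero , suc (suc zero) , _ , eq               = ⊥-elim (a≢b eq)
... | suc zero , suc (suc (suc zero)) , _ , eq         = ⊥-elim (a≢c eq)
... | suc zero , suc (suc (suc (suc zero))) , _ , eq   = ⊥-elim (a≢d eq)
... | suc (suc zero) , suc (suc (suc zero)) , _ , eq   = ⊥-elim (b≢c eq)
... | suc (suc zero) , suc (suc (suc (suc zero))) , _ , eq = ⊥-elim (b≢d eq)
... | suc (suc (suc zero)) , suc (suc (suc (suc zero))) , _ , eq = ⊥-elim (c≢d eq)
... | suc zero , suc zero , s≤s () , _
... | suc (suc zero) , suc zero , s≤s () , _
... | suc (suc zero) , suc (suc zero) , s≤s (s≤s ()) , _
... | suc (suc (suc _)) , suc zero , s≤s () , _
... | suc (suc (suc _)) , suc (suc zero) , s≤s (s≤s ()) , _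
... | suc (suc (suc _)) , suc (suc (suc zero)) , s≤s (s≤s (s≤s ())) , _
... | suc (suc (suc (suc _))) , suc (suc (suc (suc zero))) , s≤s (s≤s (s≤s (s≤s ()))) , _

module _ {n : ℕ} (G : Graph n) where
  open Graph G using (adj; irrfl) renaming (sym to adj-sym)

  E-sym : ∀ {u v} → E G u v → E G v u
  E-sym {u} {v} uv = trans (adj-sym v u) uv

  E-irrefl : ∀ {v} → ¬ E G v v
  E-irrefl {v} vv with trans (sym vv) (irrfl v)
  ... | ()

  Universal : Fin n → Set
  Universal w = ∀ t → t ≢ w → E G w t

  universal-or-non-neighbour : ∀ w → Universal w ⊎ ∃[ t ] (t ≢ w × ¬ E G w t)
  universal-or-non-neighbour w with any? (λ t → ¬? (t ≟ w) ×-dec adj w t Bool.≟ false)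
  ... | yes (t , t≢w , wt≡false) = inj₂ (t , t≢w , λ wt → Bool.not-¬ wt wt≡false)
  ... | no no-non-neighbour = inj₁ λ t t≢w →
          Bool.¬-not (λ wt≡false → no-non-neighbour (t , t≢w , wt≡false))

  walk-start : ∀ {S u v} → WalkIn G S u v → S u
  walk-start (here Su)     = Su
  walk-start (step Su _ _) = Su

  _++ʷ_ : ∀ {S u v w} → WalkIn G S u v → WalkIn G S v w → WalkIn G S u w
  here _       ++ʷ q = q
  step Su uw p ++ʷ q = step Su uw (p ++ʷ q)

  walk-leaves : ∀ {S u v} → WalkIn G S u v → u ≢ v → ∃[ w ] (S w × E G u w)
  walk-leaves (here _)              u≢u = ⊥-elim (u≢u refl)
  walk-leaves (step {w = w} _ uw p) _   = w , walk-start p , uw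

  universal⇒CDS : ∀ {C w} → Universal w → C w → CDS G C
  universal⇒CDS {C} {w} w-univ Cw = dominating , (w , Cw) , λ u v Cu Cv → to-w u Cu ++ʷ from-w v Cv
    where
    dominating : Dominating G C
    dominating v ¬Cv = w , Cw , E-sym (w-univ v λ { refl → ¬Cv Cw })
    to-w : ∀ u → C u → WalkIn G C u w
    to-w u Cu with u ≟ w
    ... | yes refl = here Cw
    ... | no u≢w   = step Cu (E-sym (w-univ u u≢w)) (here Cw)
    from-w : ∀ v → C v → WalkIn G C w v
    from-w v Cv with v ≟ w
    ... | yes refl = here Cw
    ... | no v≢w   = step Cw (w-univ v v≢w) (here Cv)

  singleton-CDS⇒universal : ∀ {C w} → CDS G C → (∀ u → C u ⇔ (u ≡ w)) → Universal w
  singleton-CDS⇒universal {C} (dominating , _) C≡⁅w⁆ t t≢w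
    with dominating t (λ Ct → t≢w (Equivalence.to (C≡⁅w⁆ t) Ct))
  ... | u , Cu , tu with Equivalence.to (C≡⁅w⁆ u) Cu
  ... | refl = E-sym tu

  universal⇒order≤1+degree : ∀ {w} → Universal w → n ≤ suc (degree G w)
  universal⇒order≤1+degree {w} w-univ = ∣tabulate-true-except∣ (adj w) w w-univ

  coalition-avoids-universal : ∀ {A B z} → ConnCoalition G A B → (_∪_ G A B) z → ¬ Universal z
  coalition-avoids-universal (_ , ¬CDS-A , _ , _) (inj₁ Az) z-univ = ¬CDS-A (universal⇒CDS z-univ Az)
  coalition-avoids-universal (_ , _ , ¬CDS-B , _) (inj₂ Bz) z-univ = ¬CDS-B (universal⇒CDS z-univ Bz)

  -- A vertex x of S has a non-neighbour y, which has a neighbour z in S. With v₀ these are four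
  -- distinct vertices, hence all of them; then x's neighbour in S must be z, and z, adjacent to
  -- every other vertex, would be universal.
  CDS-meets-universal : ∀ {v₀ S} → n ≤ 4 → Universal v₀ → CDS G S → ¬ (∀ z → S z → ¬ Universal z)
  CDS-meets-universal {v₀} {S} n≤4 v₀-univ (dominating , (x , Sx) , connected) no-universal
    with universal-or-non-neighbour x
  ... | inj₁ x-univ = no-universal x Sx x-univ
  ... | inj₂ (y , y≢x , ¬xy) = ¬¬-excluded-middle λ S-y? → absurd (neighbour-of-y S-y?)
    where
    neighbour-of-y : Dec (S y) → ∃[ z ] (S z × E G y z)
    neighbour-of-y (yes Sy) = walk-leaves (connected y x Sy Sx) y≢x
    neighbour-of-y (no ¬Sy) = dominating y ¬Sy

    v₀∉S : ¬ S v₀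
    v₀∉S Sv₀ = no-universal v₀ Sv₀ v₀-univ

    absurd : ∃[ z ] (S z × E G y z) → ⊥
    absurd (z , Sz , yz) with walk-leaves (connected x z Sx Sz) x≢z
                            | universal-or-non-neighbour z
      where
      x≢z : x ≢ z
      x≢z refl = ¬xy (E-sym yz)
    ... | _ | inj₁ z-univ = no-universal z Sz z-univ
    ... | r , Sr , xr | inj₂ (t , t≢z , ¬zt) with cover r | cover t
      where
      cover : ∀ s → s ≡ v₀ ⊎ s ≡ x ⊎ s ≡ y ⊎ s ≡ z
      cover = covered-by-four n≤4
        (λ { refl → no-universal v₀ Sx v₀-univ })
        (λ { refl → ¬xy (E-sym (v₀-univ x (λ x≡y → y≢x (sym x≡y)))) })
        (λ { refl → v₀∉S Sz })
        (λ { refl → y≢x refl })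
        (λ { refl → ¬xy (E-sym yz) })
        (λ { refl → E-irrefl yz })
    ... | inj₁ refl                 | _ = v₀∉S Sr
    ... | inj₂ (inj₁ refl)          | _ = E-irrefl xr
    ... | inj₂ (inj₂ (inj₁ refl))   | _ = ¬xy xr
    ... | inj₂ (inj₂ (inj₂ refl))   | inj₁ refl = ¬zt (E-sym (v₀-univ r λ { refl → v₀∉S Sz }))
    ... | inj₂ (inj₂ (inj₂ refl))   | inj₂ (inj₁ refl) = ¬zt (E-sym xr)
    ... | inj₂ (inj₂ (inj₂ refl))   | inj₂ (inj₂ (inj₁ refl)) = ¬zt (E-sym yz)
    ... | inj₂ (inj₂ (inj₂ refl))   | inj₂ (inj₂ (inj₂ refl)) = t≢z refl

module _ {n k : ℕ} (G : Graph n) (π : Partition G k) where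

  blocks≤order : k ≤ n
  blocks≤order = injective⇒≤ representative-injective
    where
    representative-injective : ∀ {i j} → proj₁ (nonempty π i) ≡ proj₁ (nonempty π j) → i ≡ j
    representative-injective {i} {j} eq =
      trans (sym (proj₂ (nonempty π i))) (trans (cong (part π) eq) (proj₂ (nonempty π j)))

  SingletonCDSBlocks : Set
  SingletonCDSBlocks = ∀ i → CDS G (block π i) × SingletonBlock G (block π i)

  isolated⇒universal : IsConnCoalitionPartition G π → ∀ {i} → IsolatedIn (CCG G π) i →
    ∃[ v₀ ] Universal G v₀
  isolated⇒universal ccp {i} isolated with ccp i
  ... | inj₁ (block-CDS , v₀ , block≡⁅v₀⁆) = v₀ , singleton-CDS⇒universal G block-CDS block≡⁅v₀⁆
  ... | inj₂ (j , coalition) = ⊥-elim (isolated j coalition)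

  universal⇒singleton-CDS-blocks : IsConnCoalitionPartition G π → n ≤ 4 → ∀ {v₀} → Universal G v₀ →
    SingletonCDSBlocks
  universal⇒singleton-CDS-blocks ccp n≤4 v₀-univ i with ccp i
  ... | inj₁ singleton-CDS = singleton-CDS
  ... | inj₂ (_ , coalition@(_ , _ , _ , coalition-CDS)) = ⊥-elim
    (CDS-meets-universal G n≤4 v₀-univ coalition-CDS (λ _ → coalition-avoids-universal G coalition))

  module _ (singleton-CDS : SingletonCDSBlocks) where

    all-universal : ∀ v → Universal G v
    all-universal v with singleton-CDS (part π v)
    ... | block-CDS , w , block≡⁅w⁆ with Equivalence.to (block≡⁅w⁆ v) refl
    ... | refl = singleton-CDS⇒universal G block-CDS block≡⁅w⁆

    part-injective : ∀ {u v} → part π u ≡ part π v → u ≡ v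
    part-injective {u} {v} eq with singleton-CDS (part π v)
    ... | _ , w , block≡⁅w⁆ =
      trans (Equivalence.to (block≡⁅w⁆ u) eq) (sym (Equivalence.to (block≡⁅w⁆ v) refl))

    order≡blocks : n ≡ k
    order≡blocks = ≤-antisym (injective⇒≤ part-injective) blocks≤order

    G≅K : Iso (E G) (Kadj n)
    G≅K = ↔-id _ , λ u v → mk⇔ (λ { uv refl → E-irrefl G uv })
                                (λ u≢v → all-universal u v (λ v≡u → u≢v (sym v≡u)))

    CCG≅K̄ : Iso (CCG G π) (Kbar n)
    CCG≅K̄ = subst (λ m → Fin k ↔ Fin m) (sym order≡blocks) (↔-id _)
          , λ i j → mk⇔ (λ { (_ , ¬CDS-i , _) → ¬CDS-i (proj₁ (singleton-CDS i)) }) λ ()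

lemma3 : ∀ {n k} (G : Graph n) (π : Partition G k) →
    Subcubic G → IsConnCoalitionPartition G π →
    (∃[ i ] IsolatedIn (CCG G π) i) →
    (n ≡ k) × (k ≤ 4) × Iso (E G) (Kadj n) × Iso (CCG G π) (Kbar n)
lemma3 {n} {k} G π (_ , degree≤3) ccp (i₀ , i₀-isolated) with isolated⇒universal G π ccp i₀-isolated
... | v₀ , v₀-univ =
  n≡k , subst (_≤ 4) n≡k n≤4 , G≅K G π singleton-CDS , CCG≅K̄ G π singleton-CDS
  where
  n≤4 : n ≤ 4
  n≤4 = ≤-trans (universal⇒order≤1+degree G v₀-univ) (s≤s (degree≤3 v₀))
  singleton-CDS : SingletonCDSBlocks G π
  singleton-CDS = universal⇒singleton-CDS-blocks G π ccp n≤4 v₀-univ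
  n≡k : n ≡ k
  n≡k = order≡blocks G π singleton-CDS
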